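{- Let $T$ be any token-vertex assignment for a coloured token swapping instance on a star. Then: (1) $T$ has at most $\lambda$ happy leaves; (2) $T$ has at least $\kappa$ non-trivial locked cycles; (3) if $T$ has exactly $\lambda$ happy leaves, then the set of tokens in the unlocked cycle of $T$ is a subset of $X_A$.
   Context: Coloured token swapping on a star: a star (tree with one non-leaf vertex $u$, the center) with $n$ vertices; each vertex has a colour and carries one coloured token initially, and for each colour the number of tokens of that colour equals the number of vertices of that colour. A token-vertex assignment $T$ is a bijection from tokens to vertices mapping each token to a vertex of the same colour; it defines an ordinary token swapping instance in which each token must move to its assigned vertex. Under $T$, a leaf is happy if its initial token is assigned to it. The cycles of $T$ are the cycles of the permutation on tokens in which the successor of token $t$ is the token initially on the vertex assigned to $t$; the unlocked cycle is the one containing the token initially on $u$, the others are locked, and a cycle is non-trivial if it has length at least $2$. Define the directed multigraph $G$ whose vertices are the colours and which has, for each vertex $v$ of the star with colour $c$ and initial token of colour $d$, a directed edge from $c$ to $d$ labelled $v$ (a loop if $c=d$). A leaf loop is a loop labelled by a leaf of the star; $\lambda$ is the number of leaf loops. A connected component of $G$ is trivial if it has only one vertex; $\kappa$ is the number of non-trivial connected components of $G$ other than the component containing the edge labelled $u$. Let $G'$ be $G$ with all leaf loops removed, and let $X_A$ be the set of tokens initially on the star vertices that label the edges of the connected component of $G'$ containing the edge labelled $u$. -}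

module Defs where

open import Data.Nat using (ℕ; zero; suc; _≤_)
open import Data.Fin using (Fin; _≟_)
open import Data.List using (List; length; filter)
open import Data.List using () renaming (allFin to allFinL)
open import Data.Product using (Σ; ∃; _×_; _,_)
open import Data.Sum using (_⊎_)
open import Relation.Nullary using (¬_; Dec; yes; no)
open import Relation.Nullary.Decidable using (_×-dec_; ¬?)
open import Relation.Binary.PropositionalEquality using (_≡_; _≢_)
open import Relation.Binary.Construct.Closure.ReflexiveTransitive using (Star)
open import Data.Fin.Permutation using (Permutation′; _⟨$⟩ʳ_)

-- The star has n vertices, named by Fin n; the centre is a vertex u.
-- Colours are Fin m.  col v is the colour of vertex v.
-- Tokens are named by their initial vertex: token t is the token
-- initially on vertex t, and tcol t is its colour.

#[_] : ∀ {n} {P : Fin n → Set} → (∀ x → Dec (P x)) → ℕ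
#[_] {n} P? = length (filter P? (allFinL n))

Balanced : ∀ {n m} → (col tcol : Fin n → Fin m) → Set
Balanced col tcol = ∀ c → #[ (λ v → col v ≟ c) ] ≡ #[ (λ t → tcol t ≟ c) ]

record Assignment {n m : ℕ} (col tcol : Fin n → Fin m) : Set where
  field
    perm      : Permutation′ n
    colourOK  : ∀ t → col (perm ⟨$⟩ʳ t) ≡ tcol t

module _ {n m : ℕ} (u : Fin n) (col tcol : Fin n → Fin m) where

  IsLeaf : Fin n → Set
  IsLeaf v = v ≢ u

  module _ (T : Assignment col tcol) where
    open Assignment T

    -- Since token t is the token initially on vertex t, the successor
    -- of token t (the token initially on the vertex assigned to t)
    -- is the token named  perm ⟨$⟩ʳ t .
    succ : Fin n → Fin n
    succ t = perm ⟨$⟩ʳ t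

    iter : ℕ → Fin n → Fin n
    iter zero    t = t
    iter (suc k) t = succ (iter k t)

    SameCycle : Fin n → Fin n → Set
    SameCycle t s = ∃ λ k → iter k t ≡ s

    NonTrivialCycle : Fin n → Set
    NonTrivialCycle t = succ t ≢ t

    Locked : Fin n → Set
    Locked t = ¬ SameCycle u t

    Happy : Fin n → Set
    Happy v = IsLeaf v × perm ⟨$⟩ʳ v ≡ v

    happy? : ∀ v → Dec (Happy v)
    happy? v = ¬? (v ≟ u) ×-dec (perm ⟨$⟩ʳ v ≟ v)

    numHappy : ℕ
    numHappy = #[ happy? ]

    AtLeastNTLockedCycles : ℕ → Set
    AtLeastNTLockedCycles k =
      Σ (Fin k → Fin n) λ r →
        (∀ i → NonTrivialCycle (r i) × Locked (r i)) ×
        (∀ i j → i ≢ j → ¬ SameCycle (r i) (r j))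

  -- The multigraph G: edge labelled v from col v to tcol v

  LeafLoop : Fin n → Set
  LeafLoop v = IsLeaf v × col v ≡ tcol v

  leafLoop? : ∀ v → Dec (LeafLoop v)
  leafLoop? v = ¬? (v ≟ u) ×-dec (col v ≟ tcol v)

  λ# : ℕ
  λ# = #[ leafLoop? ]

  AdjG : Fin m → Fin m → Set
  AdjG c d = ∃ λ v → (col v ≡ c × tcol v ≡ d) ⊎ (col v ≡ d × tcol v ≡ c)

  ConnG : Fin m → Fin m → Set
  ConnG = Star AdjG

  AdjG' : Fin m → Fin m → Set
  AdjG' c d = ∃ λ v → ¬ LeafLoop v ×
                ((col v ≡ c × tcol v ≡ d) ⊎ (col v ≡ d × tcol v ≡ c))

  ConnG' : Fin m → Fin m → Set
  ConnG' = Star AdjG'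

  NonTrivialComp : Fin m → Set
  NonTrivialComp c = ∃ λ d → d ≢ c × ConnG c d

  -- k pairwise distinct non-trivial components of G, other than the
  -- component containing the edge labelled u (i.e. containing col u),
  -- given by representatives.  κ is the largest k for which such a
  -- family exists.
  OtherNTComponents : ℕ → Set
  OtherNTComponents k =
    Σ (Fin k → Fin m) λ r →
      (∀ i → NonTrivialComp (r i) × ¬ ConnG (col u) (r i)) ×
      (∀ i j → i ≢ j → ¬ ConnG (r i) (r j))

  -- X_A : tokens initially on vertices labelling edges of the
  -- component of G' containing the edge labelled u.  (The edge u is in
  -- G' since u is not a leaf; edge v is in that component iff it is an
  -- edge of G' and its tail col v is connected in G' to col u.)
  InXA : Fin n → Set
  InXA t = ¬ LeafLoop t × ConnG' (col u) (col t)

module Submission where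

-- Everything rests on one observation: the token t is assigned to a
-- vertex of colour tcol t, and the token initially there is succ t, so
-- col (succ t) ≡ tcol t.  Hence the edge of G labelled t joins col t to
-- col (succ t), and following a cycle of T walks along edges of G.
--
--  * Counting: for decidable P ⊆ Q, filtering a list by P yields at
--    most as many elements as filtering by Q, and equality of the two
--    counts forces Q ⊆ P on the list.
--  * (1) A happy leaf v labels a leaf loop (col v ≡ col (succ v) ≡ tcol v).
--  * (2) Every non-trivial component of G contains a non-loop edge v;
--    the token v lies in a non-trivial cycle, which stays inside that
--    component, so distinct components other than that of col u yield
--    distinct locked cycles.
--  * (3) If the counts in (1) agree, every leaf loop is happy, i.e. a
--    fixed point of succ; the unlocked cycle cannot contain a fixed
--    point other than u itself, so it uses no leaf loop and is a walk
--    in G' starting at col u.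

open import Defs
open import Data.Nat using (ℕ; zero; suc; _≤_)
open import Data.Fin using (Fin; _≟_)
open import Data.Product using (_×_; _,_; proj₁; proj₂; ∃)
open import Data.Sum using (_⊎_; inj₁; inj₂)
open import Data.Empty using (⊥-elim)
open import Data.List using (length; filter)
open import Data.List using () renaming (allFin to allFinL)
open import Data.List.Membership.Propositional using (_∈_)
open import Data.List.Membership.Propositional.Properties
  using (∈-filter⁺; ∈-filter⁻; ∈-allFin)
open import Data.List.Relation.Binary.Sublist.Propositional using (_⊆_; ⊆-refl)
open import Data.List.Relation.Binary.Sublist.Propositional.Properties
  using (filter⁺; length-mono-≤; to-≋)
open import Data.List.Relation.Binary.Equality.Propositional using (≋⇒≡)
open import Relation.Nullary using (¬_; yes; no)
open import Relation.Unary using (Decidable)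
open import Relation.Binary.PropositionalEquality
open import Relation.Binary.Construct.Closure.ReflexiveTransitive
  using (Star; ε; _◅_; _◅◅_; reverse)
open import Function.Bundles using (Injection)
open import Function.Properties.Inverse using (↔⇒↣)

module _ {A : Set} {P Q : A → Set} (P? : Decidable P) (Q? : Decidable Q)
         (P⇒Q : ∀ {x} → P x → Q x) where

  filter-sublist : ∀ xs → filter P? xs ⊆ filter Q? xs
  filter-sublist xs = filter⁺ P? Q? (λ { refl → P⇒Q }) (⊆-refl {x = xs})

  filter-length-mono : ∀ xs → length (filter P? xs) ≤ length (filter Q? xs)
  filter-length-mono xs = length-mono-≤ (filter-sublist xs)

  -- If both filters keep equally many elements, they keep the same
  -- elements, so Q implies P on the list.
  filter-length-≡⇒ : ∀ xs → length (filter P? xs) ≡ length (filter Q? xs) →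
                     ∀ {x} → x ∈ xs → Q x → P x
  filter-length-≡⇒ xs same-length {x} x∈xs qx =
    proj₂ (∈-filter⁻ P? {xs = xs} (subst (x ∈_) (sym same-filter) (∈-filter⁺ Q? x∈xs qx)))
    where
    same-filter : filter P? xs ≡ filter Q? xs
    same-filter = ≋⇒≡ (to-≋ same-length (filter-sublist xs))

walk : ∀ {C : Set} {R : C → C → Set} (f : ℕ → C) →
       (∀ j → R (f j) (f (suc j))) → ∀ k → Star R (f 0) (f k)
walk f step zero    = ε
walk f step (suc k) = walk f step k ◅◅ (step k ◅ ε)

module _ {n m : ℕ} (u : Fin n) (col tcol : Fin n → Fin m) where

  ConnG-sym : ∀ {c d} → ConnG u col tcol c d → ConnG u col tcol d c
  ConnG-sym = reverse λ { (v , inj₁ ends) → v , inj₂ ends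
                        ; (v , inj₂ ends) → v , inj₁ ends }

  Joins : Fin n → Fin m → Fin m → Set
  Joins v c d = (col v ≡ c × tcol v ≡ d) ⊎ (col v ≡ d × tcol v ≡ c)

  joins⇒reachable : ∀ {v c d} → Joins v c d → ConnG u col tcol c (col v)
  joins⇒reachable     (inj₁ (refl , _))    = ε
  joins⇒reachable {v} (inj₂ (refl , refl)) = (v , inj₂ (refl , refl)) ◅ ε

  loop-joins : ∀ {v c d} → Joins v c d → col v ≡ tcol v → c ≡ d
  loop-joins (inj₁ (refl , refl)) loop = loop
  loop-joins (inj₂ (refl , refl)) loop = sym loop

  -- A non-trivial component of G contains an edge that is not a loop:
  -- along a walk from c to d ≢ c, the first non-loop edge is met while
  -- still at colour c.
  nonLoopEdge : ∀ {c d} → ConnG u col tcol c d → d ≢ c →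
                ∃ λ v → col v ≢ tcol v × ConnG u col tcol c (col v)
  nonLoopEdge ε d≢c = ⊥-elim (d≢c refl)
  nonLoopEdge ((v , joins) ◅ path) d≢c with col v ≟ tcol v
  ... | no notLoop = v , notLoop , joins⇒reachable joins
  ... | yes loop with loop-joins joins loop
  ...   | refl = nonLoopEdge path d≢c

  module _ (T : Assignment col tcol) where
    open Assignment T

    private
      succ′ = succ u col tcol T
      iter′ = iter u col tcol T

    col-succ : ∀ t → col (succ′ t) ≡ tcol t
    col-succ = colourOK

    succ-injective : ∀ {s t} → succ′ s ≡ succ′ t → s ≡ t
    succ-injective = Injection.injective (↔⇒↣ perm)

    cycleEdge : ∀ t → Joins t (col t) (col (succ′ t))
    cycleEdge t = inj₁ (refl , sym (col-succ t))

    sameCycle⇒ConnG : ∀ {s t} → SameCycle u col tcol T s t →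
                      ConnG u col tcol (col s) (col t)
    sameCycle⇒ConnG {s} (k , refl) =
      walk (λ j → col (iter′ j s)) (λ j → iter′ j s , cycleEdge (iter′ j s)) k

    orbit-fixedPoint : ∀ k → succ′ (iter′ k u) ≡ iter′ k u → iter′ k u ≡ u
    orbit-fixedPoint zero    _     = refl
    orbit-fixedPoint (suc k) fixed = trans previous (orbit-fixedPoint k previous)
      where
      previous : succ′ (iter′ k u) ≡ iter′ k u
      previous = succ-injective fixed

    happy⇒leafLoop : ∀ v → Happy u col tcol T v → LeafLoop u col tcol v
    happy⇒leafLoop v (leaf , fixed) = leaf , trans (cong col (sym fixed)) (col-succ v)

    happy≤λ : numHappy u col tcol T ≤ λ# u col tcol
    happy≤λ = filter-length-mono (happy? u col tcol T) (leafLoop? u col tcol)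
                                 (happy⇒leafLoop _) (allFinL n)

    lockedCycles : ∀ k → OtherNTComponents u col tcol k →
                   AtLeastNTLockedCycles u col tcol T k
    lockedCycles k (r , nonTrivialOther , disjoint) =
      token , (λ i → nonTrivial i , locked i) , distinct
      where
      edgeIn : ∀ i → ∃ λ v → col v ≢ tcol v × ConnG u col tcol (r i) (col v)
      edgeIn i with proj₁ (nonTrivialOther i)
      ... | d , d≢r , r⇝d = nonLoopEdge r⇝d d≢r

      token : Fin k → Fin n
      token i = proj₁ (edgeIn i)

      inComponent : ∀ i → ConnG u col tcol (r i) (col (token i))
      inComponent i = proj₂ (proj₂ (edgeIn i))

      nonTrivial : ∀ i → NonTrivialCycle u col tcol T (token i)
      nonTrivial i fixed =
        proj₁ (proj₂ (edgeIn i)) (trans (cong col (sym fixed)) (col-succ (token i)))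

      locked : ∀ i → Locked u col tcol T (token i)
      locked i u~t = proj₂ (nonTrivialOther i)
        (sameCycle⇒ConnG u~t ◅◅ ConnG-sym (inComponent i))

      distinct : ∀ i j → i ≢ j → ¬ SameCycle u col tcol T (token i) (token j)
      distinct i j i≢j ti~tj = disjoint i j i≢j
        (inComponent i ◅◅ sameCycle⇒ConnG ti~tj ◅◅ ConnG-sym (inComponent j))

    unlocked⊆XA : numHappy u col tcol T ≡ λ# u col tcol →
                  ∀ t → SameCycle u col tcol T u t → InXA u col tcol t
    unlocked⊆XA same t (k , refl) = noLeafLoop k , walkInG′ k
      where
      leafLoop⇒happy : ∀ v → LeafLoop u col tcol v → Happy u col tcol T v
      leafLoop⇒happy v = filter-length-≡⇒ (happy? u col tcol T) (leafLoop? u col tcol)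
                           (happy⇒leafLoop _) (allFinL n) same (∈-allFin v)

      noLeafLoop : ∀ j → ¬ LeafLoop u col tcol (iter′ j u)
      noLeafLoop j loop with leafLoop⇒happy (iter′ j u) loop
      ... | leaf , fixed = leaf (orbit-fixedPoint j fixed)

      walkInG′ : ∀ j → ConnG' u col tcol (col u) (col (iter′ j u))
      walkInG′ = walk (λ j → col (iter′ j u))
        (λ j → iter′ j u , noLeafLoop j , cycleEdge (iter′ j u))

-- The three parts hold for every assignment.
lemma6p5 : ∀ {n m : ℕ} (u : Fin n) (col tcol : Fin n → Fin m) →
    3 ≤ n → Balanced col tcol → (T : Assignment col tcol) →
    (numHappy u col tcol T ≤ λ# u col tcol)
    × (∀ k → OtherNTComponents u col tcol k →
         AtLeastNTLockedCycles u col tcol T k)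
    × (numHappy u col tcol T ≡ λ# u col tcol →
         ∀ t → SameCycle u col tcol T u t → InXA u col tcol t)
lemma6p5 u col tcol _ _ T =
  happy≤λ u col tcol T , lockedCycles u col tcol T , unlocked⊆XA u col tcol T
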